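{- The set $S=\{1,0,-1,-2,\dots\}\cup\{\omega\}$ is the smallest set such that for every graph $G$ with at least $3$ vertices, $\mathrm{Alph}(\Delta L_G)\subseteq S$; that is, every letter of $\Delta L_G$ belongs to $S$ for every such $G$, and every element of $S$ occurs as a letter of $\Delta L_G$ for some such $G$.
   Context: All graphs are finite, simple, undirected. For a graph $G$ with $n$ vertices, $L_G(i)$ ($0\le i\le n$) is the maximum number of leaves (degree-1 vertices) of an induced subtree of $G$ with exactly $i$ vertices, with $\max\emptyset=-\infty$. The leaf word $\Delta L_G$ is the word over $\mathbb{Z}\cup\{\omega\}$ of length $n-3$ whose $i$-th letter ($1\le i\le n-3$) is $L_G(i+3)-L_G(i+2)$, set to $\omega$ whenever $L_G(i+2)=-\infty$ or $L_G(i+3)=-\infty$. $\mathrm{Alph}(w)$ is the set of letters occurring in $w$. -}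

module Defs where

open import Data.Nat using (ℕ; zero; suc; _+_; _≤_; _∸_; _≡ᵇ_)
open import Data.Integer as ℤ using (ℤ; +_)
open import Data.Bool using (Bool; true; false; _∧_)
open import Data.Fin using (Fin; zero; suc; inject₁; fromℕ)
open import Data.Fin.Subset using (Subset; _∈_; _∩_; ∣_∣)
open import Data.Vec using (tabulate; lookup)
open import Data.Product using (Σ; ∃; _×_)
open import Data.Unit using (⊤)
open import Function.Definitions using (Injective)
open import Relation.Nullary using (¬_)
open import Relation.Binary.PropositionalEquality using (_≡_)

record Graph (n : ℕ) : Set where
  field
    E      : Fin n → Fin n → Bool
    E-sym  : ∀ u v → E u v ≡ E v u
    E-irr  : ∀ v → E v v ≡ false
open Graph public

module _ {n : ℕ} (G : Graph n) where

  data Walk (S : Subset n) : Fin n → Fin n → Set where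
    here : ∀ {u} → u ∈ S → Walk S u u
    step : ∀ {u w v} → u ∈ S → E G u w ≡ true → Walk S w v → Walk S u v

  Connected : Subset n → Set
  Connected S = ∀ u v → u ∈ S → v ∈ S → Walk S u v

  -- a cycle of length k+3 in G[S]: distinct vertices c 0, …, c (k+2), all in S,
  -- consecutive ones adjacent and the last adjacent to the first
  record Cycle (S : Subset n) : Set where
    field
      k      : ℕ
      c      : Fin (3 + k) → Fin n
      c-inj  : Injective _≡_ _≡_ c
      c-in   : ∀ j → c j ∈ S
      c-adj  : ∀ (j : Fin (2 + k)) → E G (c (inject₁ j)) (c (suc j)) ≡ true
      c-close : E G (c (fromℕ (2 + k))) (c zero) ≡ true

  IsInducedTree : Subset n → Set
  IsInducedTree S = Connected S × ¬ Cycle S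

  nbhd : Fin n → Subset n
  nbhd v = tabulate (E G v)

  deg : Subset n → Fin n → ℕ
  deg S v = ∣ S ∩ nbhd v ∣

  leaves : Subset n → ℕ
  leaves S = ∣ tabulate (λ v → lookup S v ∧ (deg S v ≡ᵇ 1)) ∣

data ℕ-∞ : Set where
  -∞  : ℕ-∞
  fin : ℕ → ℕ-∞

-- IsL G i x  :  x = L_G(i)  (max over induced subtrees with i vertices; max ∅ = -∞)
IsL : ∀ {n} → Graph n → ℕ → ℕ-∞ → Set
IsL {n} G i -∞ = ¬ (Σ (Subset n) λ S → IsInducedTree G S × ∣ S ∣ ≡ i)
IsL {n} G i (fin l) =
  (Σ (Subset n) λ S → IsInducedTree G S × ∣ S ∣ ≡ i × leaves G S ≡ l) ×
  (∀ (S : Subset n) → IsInducedTree G S → ∣ S ∣ ≡ i → leaves G S ≤ l)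

data Letter : Set where
  num : ℤ → Letter
  ω   : Letter

diffL : ℕ-∞ → ℕ-∞ → Letter
diffL (fin a) (fin b) = num (+ b ℤ.- + a)
diffL _ _ = ω

-- LetterAt G i a : the i-th letter of ΔL_G is a   (for 1 ≤ i ≤ n-3)
LetterAt : ∀ {n} → Graph n → ℕ → Letter → Set
LetterAt G i a = ∃ λ x → ∃ λ y → IsL G (i + 2) x × IsL G (i + 3) y × a ≡ diffL x y

InAlph : ∀ {n} → Graph n → Letter → Set
InAlph {n} G a = ∃ λ i → 1 ≤ i × i ≤ n ∸ 3 × LetterAt G i a

InS : Letter → Set
InS (num z) = z ℤ.≤ + 1
InS ω = ⊤

-- Deleting a leaf from an induced tree on k + 1 ≥ 4 vertices leaves an induced tree on k
-- vertices in which every other leaf is still a leaf, so L(k + 1) ≤ L(k) + 1 and no letter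
-- exceeds 1. Conversely, the edgeless graph has no induced tree on 3 or 4 vertices, giving ω,
-- and the disjoint union of the star K(1,m) with a path on m + 2 vertices has L(t + 1) = t for
-- 2 ≤ t ≤ m (substars) but L(m + 2) = 2: an induced tree that large does not fit into the star
-- component, so it is the whole path. Its letters include 0 (m = 2), 1 (m = 3) and 2 − m.
module Submission where

open import Data.Bool using (Bool; true; false; T; _∧_; _∨_)
open import Data.Bool.Properties using (T-≡; T-∧; ∨-comm)
open import Data.Empty using (⊥-elim)
open import Data.Fin as Fin using (Fin; zero; suc; toℕ; inject₁; fromℕ; fromℕ<)
import Data.Fin.Induction as Finᵢ
import Data.Fin.Properties as Finₚ
open import Data.Fin.Relation.Unary.Top using (view; ‵fromℕ; ‵inject₁)
open import Data.Fin.Subset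
  using (Subset; inside; outside; _∈_; _∉_; _⊆_; _∩_; _-_; ∁; ⁅_⁆; ∣_∣; Nonempty)
open import Data.Fin.Subset.Properties
  using (p─⊥≡p; p─q⊆p; x∈p∧x≢y⇒x∈p-y; x∈p∩q⁺; x∈p∩q⁻; x∈⁅y⁆⇔x≡y; ∣⁅x⁆∣≡1;
         p⊆q⇒∣p∣≤∣q∣; p⊂q⇒∣p∣<∣q∣; ⊆-antisym; _∈?_; nonempty?; Empty-unique; ∣⊥∣≡0;
         ∣∁p∣≡n∸∣p∣; x∈∁p⇒x∉p; x∉p⇒x∈∁p)
open import Data.Integer as ℤ using (+_; -[1+_]; _⊖_)
import Data.Integer.Properties as ℤₚ
open import Data.Nat
  using (ℕ; zero; suc; _+_; _∸_; _≤_; _<_; _≥_; _<ᵇ_; z≤n; s≤s; z<s; s≤s⁻¹; _≡ᵇ_; _≟_; _≤?_; _<?_)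
open import Data.Nat.Properties
open import Data.Product using (Σ; ∃; _×_; _,_; proj₁; proj₂; map₁; map₂)
open import Data.Sum using (_⊎_; inj₁; inj₂)
open import Data.Unit using (tt)
open import Data.Vec using (_∷_; tabulate; lookup; here; there)
open import Data.Vec.Properties using (lookup∘tabulate; []=⇒lookup; lookup⇒[]=)
open import Function using (_∘_)
open import Function.Bundles using (Equivalence)
open import Induction.WellFounded using (module All)
open import Relation.Nullary using (¬_; Dec; yes; no; does; proof)
open import Relation.Nullary.Reflects using (Reflects; invert)
open import Relation.Nullary.Decidable using (dec-true; dec-false; _⊎-dec_)
open import Relation.Binary.PropositionalEquality

open import Defs

open Equivalence using (to; from)

private variable
  n : ℕ
  p q : Subset n
  x y : Fin n

x∈p⇒T[p[x]] : x ∈ p → T (lookup p x)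
x∈p⇒T[p[x]] x∈p = from T-≡ ([]=⇒lookup x∈p)

T[p[x]]⇒x∈p : T (lookup p x) → x ∈ p
T[p[x]]⇒x∈p {p = p} {x} t = lookup⇒[]= x p (to T-≡ t)

x∈tabulate⁺ : ∀ {f : Fin n → Bool} → T (f x) → x ∈ tabulate f
x∈tabulate⁺ {x = x} {f} t = T[p[x]]⇒x∈p (subst T (sym (lookup∘tabulate f x)) t)

x∈tabulate⁻ : ∀ {f : Fin n → Bool} → x ∈ tabulate f → T (f x)
x∈tabulate⁻ {x = x} {f} x∈ = subst T (lookup∘tabulate f x) (x∈p⇒T[p[x]] x∈)

x∈p-y⁻ : x ∈ p - y → x ∈ p × x ≢ y
x∈p-y⁻ {x = zero}  {inside ∷ p} {zero}  ()
x∈p-y⁻ {x = zero}  {inside ∷ p} {suc y} here = here , λ ()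
x∈p-y⁻ {x = suc x} {s ∷ p}      {zero}  (there x∈) = there (subst (x ∈_) (p─⊥≡p p) x∈) , λ ()
x∈p-y⁻ {x = suc x} {s ∷ p}      {suc y} (there x∈) =
  map₂ (λ x≢y eq → x≢y (Finₚ.suc-injective eq)) (map₁ there (x∈p-y⁻ x∈))

x∈p⇒∣p∣≡1+∣p-x∣ : x ∈ p → ∣ p ∣ ≡ suc ∣ p - x ∣
x∈p⇒∣p∣≡1+∣p-x∣ {x = zero}  {inside ∷ p}  here       = cong (suc ∘ ∣_∣) (sym (p─⊥≡p p))
x∈p⇒∣p∣≡1+∣p-x∣ {x = suc x} {inside ∷ p}  (there x∈) = cong suc (x∈p⇒∣p∣≡1+∣p-x∣ x∈)
x∈p⇒∣p∣≡1+∣p-x∣ {x = suc x} {outside ∷ p} (there x∈) = x∈p⇒∣p∣≡1+∣p-x∣ x∈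

∣p∣≤1+∣p-x∣ : ∀ (x : Fin n) p → ∣ p ∣ ≤ suc ∣ p - x ∣
∣p∣≤1+∣p-x∣ zero    (inside  ∷ p) = ≤-reflexive (cong suc (cong ∣_∣ (sym (p─⊥≡p p))))
∣p∣≤1+∣p-x∣ zero    (outside ∷ p) = ≤-trans (≤-reflexive (cong ∣_∣ (sym (p─⊥≡p p)))) (n≤1+n _)
∣p∣≤1+∣p-x∣ (suc x) (inside  ∷ p) = s≤s (∣p∣≤1+∣p-x∣ x p)
∣p∣≤1+∣p-x∣ (suc x) (outside ∷ p) = ∣p∣≤1+∣p-x∣ x p

0<∣p∣⇒Nonempty : ∀ (p : Subset n) → 0 < ∣ p ∣ → Nonempty p
0<∣p∣⇒Nonempty (inside  ∷ p) _ = zero , here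
0<∣p∣⇒Nonempty (outside ∷ p) h = let (x , x∈p) = 0<∣p∣⇒Nonempty p h in suc x , there x∈p

x∈p⇒0<∣p∣ : x ∈ p → 0 < ∣ p ∣
x∈p⇒0<∣p∣ x∈p rewrite x∈p⇒∣p∣≡1+∣p-x∣ x∈p = z<s

x≢y⇒2≤∣p∣ : x ∈ p → y ∈ p → x ≢ y → 2 ≤ ∣ p ∣
x≢y⇒2≤∣p∣ x∈p y∈p x≢y rewrite x∈p⇒∣p∣≡1+∣p-x∣ x∈p =
  s≤s (x∈p⇒0<∣p∣ (x∈p∧x≢y⇒x∈p-y y∈p (x≢y ∘ sym)))

∣p∣≡1⇒x≡y : ∣ p ∣ ≡ 1 → x ∈ p → y ∈ p → x ≡ y
∣p∣≡1⇒x≡y {x = x} {y} ∣p∣≡1 x∈p y∈p with x Fin.≟ y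
... | yes x≡y = x≡y
... | no  x≢y = ⊥-elim (<⇒≱ (x≢y⇒2≤∣p∣ x∈p y∈p x≢y) (≤-reflexive ∣p∣≡1))

p⊆⁅x⁆⇒∣p∣≤1 : p ⊆ ⁅ x ⁆ → ∣ p ∣ ≤ 1
p⊆⁅x⁆⇒∣p∣≤1 {x = x} p⊆ = ≤-trans (p⊆q⇒∣p∣≤∣q∣ p⊆) (≤-reflexive (∣⁅x⁆∣≡1 x))

p⊆⁅x,y⁆⇒∣p∣≤2 : (∀ {z} → z ∈ p → z ≡ x ⊎ z ≡ y) → ∣ p ∣ ≤ 2
p⊆⁅x,y⁆⇒∣p∣≤2 {p = p} {x} {y} p⊆ = ≤-trans (∣p∣≤1+∣p-x∣ x p) (s≤s (p⊆⁅x⁆⇒∣p∣≤1 p-x⊆⁅y⁆))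
  where
  p-x⊆⁅y⁆ : p - x ⊆ ⁅ y ⁆
  p-x⊆⁅y⁆ z∈ with x∈p-y⁻ z∈
  ... | z∈p , z≢x with p⊆ z∈p
  ...   | inj₁ z≡x = ⊥-elim (z≢x z≡x)
  ...   | inj₂ z≡y = from x∈⁅y⁆⇔x≡y z≡y

p⊆q∧∣q∣≤∣p∣⇒p≡q : p ⊆ q → ∣ q ∣ ≤ ∣ p ∣ → p ≡ q
p⊆q∧∣q∣≤∣p∣⇒p≡q {p = p} {q} p⊆q ∣q∣≤∣p∣ = ⊆-antisym p⊆q q⊆p
  where
  q⊆p : q ⊆ p
  q⊆p {z} z∈q with z ∈? p
  ... | yes z∈p = z∈p
  ... | no  z∉p = ⊥-elim (<⇒≱ (p⊂q⇒∣p∣<∣q∣ (p⊆q , z , z∈q , z∉p)) ∣q∣≤∣p∣)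

argmax : ∀ {m} (f : Fin (suc m) → ℕ) → ∃ λ j → ∀ i → f i ≤ f j
argmax {zero}  f = zero , λ { zero → ≤-refl }
argmax {suc m} f with argmax (f ∘ suc)
... | j , max with f zero ≤? f (suc j)
...   | yes f0≤ = suc j , λ { zero → f0≤ ; (suc i) → max i }
...   | no  f0≰ = zero , λ { zero → ≤-refl ; (suc i) → ≤-trans (max i) (<⇒≤ (≰⇒> f0≰)) }

below : ℕ → Subset n
below k = tabulate (λ v → toℕ v <ᵇ k)

∈-below⁺ : ∀ {k} → toℕ x < k → x ∈ below k
∈-below⁺ x<k = x∈tabulate⁺ (<⇒<ᵇ x<k)

∈-below⁻ : ∀ {k} → x ∈ below k → toℕ x < k
∈-below⁻ {x = x} {k} x∈ = <ᵇ⇒< (toℕ x) k (x∈tabulate⁻ x∈)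

∣below∣ : ∀ k → k ≤ n → ∣ below {n} k ∣ ≡ k
∣below∣ {zero}  zero    _       = refl
∣below∣ {suc n} zero    _       = ∣below∣ {n} zero z≤n
∣below∣ {suc n} (suc k) (s≤s h) = cong suc (∣below∣ k h)

module GraphProperties {n : ℕ} (G : Graph n) where

  private variable
    S S′ : Subset n
    u v w a b : Fin n

  walk-head : Walk G S u v → u ∈ S
  walk-head (here u∈) = u∈
  walk-head (step u∈ _ _) = u∈

  walk-trans : Walk G S u v → Walk G S v w → Walk G S u w
  walk-trans (here _)      q = q
  walk-trans (step u∈ e p) q = step u∈ e (walk-trans p q)

  walk-sym : Walk G S u v → Walk G S v u
  walk-sym (here u∈)     = here u∈
  walk-sym (step u∈ e p) =
    walk-trans (walk-sym p) (step (walk-head p) (trans (E-sym G _ _) e) (here u∈))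

  walk-preserves : ∀ {Q : Fin n → Set} → (∀ {a b} → b ∈ S → E G a b ≡ true → Q a → Q b) →
                   Walk G S u v → Q u → Q v
  walk-preserves closed (here _)     qu = qu
  walk-preserves closed (step _ e p) qu = walk-preserves closed p (closed (walk-head p) e qu)

  E⇒≢ : E G u v ≡ true → u ≢ v
  E⇒≢ {u} e refl with trans (sym e) (E-irr G u)
  ... | ()

  ∈-nbhd⁺ : w ∈ S → E G v w ≡ true → w ∈ S ∩ nbhd G v
  ∈-nbhd⁺ w∈ e = x∈p∩q⁺ (w∈ , x∈tabulate⁺ (from T-≡ e))

  ∈-nbhd⁻ : w ∈ S ∩ nbhd G v → w ∈ S × E G v w ≡ true
  ∈-nbhd⁻ {S = S} {v = v} w∈ = map₂ (to T-≡ ∘ x∈tabulate⁻) (x∈p∩q⁻ S (nbhd G v) w∈)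

  deg-mono : S ⊆ S′ → deg G S v ≤ deg G S′ v
  deg-mono S⊆S′ = p⊆q⇒∣p∣≤∣q∣ λ w∈ → let (w∈S , e) = ∈-nbhd⁻ w∈ in ∈-nbhd⁺ (S⊆S′ w∈S) e

  deg≡1⇒neighbour : deg G S v ≡ 1 → ∃ λ w → w ∈ S × E G v w ≡ true
  deg≡1⇒neighbour {S} {v} d =
    map₂ ∈-nbhd⁻ (0<∣p∣⇒Nonempty (S ∩ nbhd G v) (subst (0 <_) (sym d) z<s))

  deg≡1⇒≡ : deg G S v ≡ 1 → a ∈ S → b ∈ S → E G v a ≡ true → E G v b ≡ true → a ≡ b
  deg≡1⇒≡ d a∈ b∈ ea eb = ∣p∣≡1⇒x≡y d (∈-nbhd⁺ a∈ ea) (∈-nbhd⁺ b∈ eb)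

  neighbour-index-unique⇒deg≡1 : ∀ {k} → (∀ {w} → w ∈ S → E G v w ≡ true → toℕ w ≡ k) →
                                 a ∈ S → E G v a ≡ true → deg G S v ≡ 1
  neighbour-index-unique⇒deg≡1 index a∈ ea = ≤-antisym
    (p⊆⁅x⁆⇒∣p∣≤1 λ w∈ → let (w∈S , e) = ∈-nbhd⁻ w∈ in
      from x∈⁅y⁆⇔x≡y (Finₚ.toℕ-injective (trans (index w∈S e) (sym (index a∈ ea)))))
    (x∈p⇒0<∣p∣ (∈-nbhd⁺ a∈ ea))

  leafSet : Subset n → Subset n
  leafSet S = tabulate (λ v → lookup S v ∧ (deg G S v ≡ᵇ 1))

  ∈-leafSet⁺ : v ∈ S → deg G S v ≡ 1 → v ∈ leafSet S
  ∈-leafSet⁺ v∈ d = x∈tabulate⁺ (from T-∧ (x∈p⇒T[p[x]] v∈ , ≡⇒≡ᵇ _ 1 d))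

  ∈-leafSet⁻ : v ∈ leafSet S → v ∈ S × deg G S v ≡ 1
  ∈-leafSet⁻ v∈ = let (t , d) = to T-∧ (x∈tabulate⁻ v∈) in T[p[x]]⇒x∈p t , ≡ᵇ⇒≡ _ 1 d

  leafSet⊆ : leafSet S ⊆ S
  leafSet⊆ = proj₁ ∘ ∈-leafSet⁻

  -- A walk from u never leaves {u, v}: each of the two is the other's only neighbour.
  adjacent-leaves⇒∣S∣≤2 : Connected G S → u ∈ S → v ∈ S → E G u v ≡ true →
                          deg G S u ≡ 1 → deg G S v ≡ 1 → ∣ S ∣ ≤ 2
  adjacent-leaves⇒∣S∣≤2 {S} {u} {v} con u∈ v∈ u~v du dv =
    p⊆⁅x,y⁆⇒∣p∣≤2 λ {w} w∈ → walk-preserves stays (con u w u∈ w∈) (inj₁ refl)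
    where
    stays : ∀ {a b} → b ∈ S → E G a b ≡ true → a ≡ u ⊎ a ≡ v → b ≡ u ⊎ b ≡ v
    stays b∈ u~b (inj₁ refl) = inj₂ (deg≡1⇒≡ du b∈ v∈ u~b u~v)
    stays b∈ v~b (inj₂ refl) = inj₁ (deg≡1⇒≡ dv b∈ u∈ v~b (trans (E-sym G v u) u~v))

  connected⇒nonLeaf : Connected G S → 3 ≤ ∣ S ∣ → ∃ λ z → z ∈ S × z ∉ leafSet S
  connected⇒nonLeaf {S} con 3≤∣S∣ with 0<∣p∣⇒Nonempty S (≤-trans (s≤s z≤n) 3≤∣S∣)
  ... | u , u∈ with deg G S u ≟ 1
  ... | no ¬du = u , u∈ , ¬du ∘ proj₂ ∘ ∈-leafSet⁻ {S = S}
  ... | yes du with deg≡1⇒neighbour {S = S} du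
  ...   | x , x∈ , u~x with deg G S x ≟ 1
  ...     | no ¬dx = x , x∈ , ¬dx ∘ proj₂ ∘ ∈-leafSet⁻ {S = S}
  ...     | yes dx = ⊥-elim (<⇒≱ 3≤∣S∣ (adjacent-leaves⇒∣S∣≤2 con u∈ x∈ u~x du dx))

  leaves<∣S∣ : Connected G S → 3 ≤ ∣ S ∣ → leaves G S < ∣ S ∣
  leaves<∣S∣ con 3≤∣S∣ =
    let (z , z∈ , z∉) = connected⇒nonLeaf con 3≤∣S∣ in p⊂q⇒∣p∣<∣q∣ (leafSet⊆ , z , z∈ , z∉)

  cycle-mono : S ⊆ S′ → Cycle G S → Cycle G S′
  cycle-mono S⊆S′ cy = record
    { k = k ; c = c ; c-inj = c-inj ; c-in = S⊆S′ ∘ c-in ; c-adj = c-adj ; c-close = c-close }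
    where open Cycle cy

  module _ {T : Subset n} {v : Fin n} (T-tree : IsInducedTree G T) (3≤∣T∣ : 3 ≤ ∣ T ∣)
           (v-leaf : v ∈ leafSet T) where

    private
      v∈T : v ∈ T
      v∈T = proj₁ (∈-leafSet⁻ {S = T} v-leaf)

      dv : deg G T v ≡ 1
      dv = proj₂ (∈-leafSet⁻ {S = T} v-leaf)

      -- A walk through v enters and leaves it via its unique neighbour, so v can be cut out.
      avoid : Walk G T a b → a ≢ v → b ≢ v → Walk G (T - v) a b
      avoid (here a∈) a≢v _ = here (x∈p∧x≢y⇒x∈p-y a∈ a≢v)
      avoid {a} (step {w = x} a∈ a~x p) a≢v b≢v with x Fin.≟ v
      ... | no x≢v = step (x∈p∧x≢y⇒x∈p-y a∈ a≢v) a~x (avoid p x≢v b≢v)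
      ... | yes refl with p
      ...   | here _ = ⊥-elim (b≢v refl)
      ...   | step _ v~y q with deg≡1⇒≡ dv (walk-head q) a∈ v~y (trans (E-sym G v a) a~x)
      ...     | refl = avoid q a≢v b≢v

    minus-leaf-isInducedTree : IsInducedTree G (T - v)
    minus-leaf-isInducedTree = connected , proj₂ T-tree ∘ cycle-mono (p─q⊆p T ⁅ v ⁆)
      where
      connected : Connected G (T - v)
      connected a b a∈ b∈ =
        let (a∈T , a≢v) = x∈p-y⁻ a∈ ; (b∈T , b≢v) = x∈p-y⁻ b∈
        in  avoid (proj₁ T-tree a b a∈T b∈T) a≢v b≢v

    leaves≤1+leaves-minus-leaf : leaves G T ≤ suc (leaves G (T - v))
    leaves≤1+leaves-minus-leaf =
      ≤-trans (∣p∣≤1+∣p-x∣ v (leafSet T)) (s≤s (p⊆q⇒∣p∣≤∣q∣ still-leaf))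
      where
      still-leaf : leafSet T - v ⊆ leafSet (T - v)
      still-leaf u∈ with x∈p-y⁻ u∈
      ... | u-leaf , u≢v with ∈-leafSet⁻ {S = T} u-leaf
      ...   | u∈T , du with deg≡1⇒neighbour {S = T} du
      ...     | x , x∈T , u~x = ∈-leafSet⁺ (x∈p∧x≢y⇒x∈p-y u∈T u≢v) (≤-antisym
                  (≤-trans (deg-mono {S = T - v} (p─q⊆p T ⁅ v ⁆)) (≤-reflexive du))
                  (x∈p⇒0<∣p∣ (∈-nbhd⁺ (x∈p∧x≢y⇒x∈p-y x∈T x≢v) u~x)))
        where
        x≢v : x ≢ v
        x≢v refl = <⇒≱ 3≤∣T∣ (adjacent-leaves⇒∣S∣≤2 (proj₁ T-tree) u∈T v∈T u~x du dv)

  module _ (cy : Cycle G S) where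
    open Cycle cy

    cycle-neighbours : ∀ j → ∃ λ i → ∃ λ i′ →
                       i ≢ i′ × E G (c j) (c i) ≡ true × E G (c j) (c i′) ≡ true
    cycle-neighbours j with view j
    ... | ‵fromℕ = inject₁ (fromℕ (1 + k)) , zero , (λ ()) ,
                   trans (E-sym G _ _) (c-adj (fromℕ (1 + k))) , c-close
    ... | ‵inject₁ zero = fromℕ (2 + k) , suc zero , (λ ()) ,
                          trans (E-sym G _ _) c-close , c-adj zero
    ... | ‵inject₁ (suc i) = inject₁ (inject₁ i) , suc (suc i) , i′≢i″ ,
                             trans (E-sym G _ _) (c-adj (inject₁ i)) , c-adj (suc i)
      where
      i′≢i″ : inject₁ (inject₁ i) ≢ suc (suc i)
      i′≢i″ eq = <⇒≢ (m<n⇒m<1+n (n<1+n (toℕ i)))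
        (trans (sym (trans (Finₚ.toℕ-inject₁ (inject₁ i)) (Finₚ.toℕ-inject₁ i))) (cong toℕ eq))

  -- The cycle vertex of largest index would have two distinct lower neighbours.
  lower-neighbour-unique⇒acyclic :
    (∀ {v a b} → E G v a ≡ true → E G v b ≡ true → toℕ a < toℕ v → toℕ b < toℕ v → a ≡ b) →
    ¬ Cycle G S
  lower-neighbour-unique⇒acyclic unique cy with argmax (toℕ ∘ Cycle.c cy)
  ... | j , max with cycle-neighbours cy j
  ...   | i , i′ , i≢i′ , ei , ei′ =
    i≢i′ (c-inj (unique ei ei′ (lower ei (max i)) (lower ei′ (max i′))))
    where
    open Cycle cy
    lower : ∀ {i} → E G (c j) (c i) ≡ true → toℕ (c i) ≤ toℕ (c j) → toℕ (c i) < toℕ (c j)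
    lower e ci≤cj = ≤∧≢⇒< ci≤cj (λ eq → E⇒≢ e (sym (Finₚ.toℕ-injective eq)))

  descending⇒connected : ∀ {r} → r ∈ S →
    (∀ {u} → u ∈ S → u ≢ r → ∃ λ w → w ∈ S × E G u w ≡ true × toℕ w < toℕ u) →
    Connected G S
  descending⇒connected {S} {r} r∈ descend u v u∈ v∈ =
    walk-trans (reach u u∈) (walk-sym (reach v v∈))
    where
    reach : ∀ u → u ∈ S → Walk G S u r
    reach = All.wfRec Finᵢ.<-wellFounded _ (λ u → u ∈ S → Walk G S u r) step′
      where
      step′ : ∀ u → (∀ {w} → toℕ w < toℕ u → w ∈ S → Walk G S w r) → u ∈ S → Walk G S u r
      step′ u rec u∈ with u Fin.≟ r
      ... | yes refl = here r∈
      ... | no  u≢r  = let (w , w∈ , u~w , w<u) = descend u∈ u≢r in step u∈ u~w (rec w<u w∈)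

  ∣S∣≡1+k⇒leaves≤k : ∀ {k} → Connected G S → 2 ≤ k → ∣ S ∣ ≡ suc k → leaves G S ≤ k
  ∣S∣≡1+k⇒leaves≤k {S} con 2≤k ∣S∣≡1+k =
    s≤s⁻¹ (subst (leaves G S <_) ∣S∣≡1+k (leaves<∣S∣ con (subst (3 ≤_) (sym ∣S∣≡1+k) (s≤s 2≤k))))

-- Letters are at most 1

module _ {n : ℕ} (G : Graph n) where
  open GraphProperties G

  L-step≤1 : ∀ {k x y} → 2 ≤ k → IsL G k (fin x) → IsL G (suc k) (fin y) → y ≤ suc x
  L-step≤1 {k} {x} 2≤k (_ , maximal) ((T , T-tree , ∣T∣≡1+k , refl) , _) with nonempty? (leafSet T)
  ... | no  no-leaf = subst (_≤ suc x) (sym (trans (cong ∣_∣ (Empty-unique no-leaf)) (∣⊥∣≡0 n))) z≤n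
  ... | yes (v , v-leaf) = ≤-trans (leaves≤1+leaves-minus-leaf T-tree 3≤∣T∣ v-leaf)
    (s≤s (maximal (T - v) (minus-leaf-isInducedTree T-tree 3≤∣T∣ v-leaf) ∣T-v∣≡k))
    where
    3≤∣T∣ : 3 ≤ ∣ T ∣
    3≤∣T∣ = subst (3 ≤_) (sym ∣T∣≡1+k) (s≤s 2≤k)
    ∣T-v∣≡k : ∣ T - v ∣ ≡ k
    ∣T-v∣≡k = suc-injective (trans (sym (x∈p⇒∣p∣≡1+∣p-x∣ (leafSet⊆ {S = T} v-leaf))) ∣T∣≡1+k)

m≤1+n⇒m-n≤1 : ∀ {m n} → m ≤ suc n → + m ℤ.- + n ℤ.≤ + 1
m≤1+n⇒m-n≤1 {m} {n} m≤1+n = begin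
  + m ℤ.- + n    ≡⟨ ℤₚ.m-n≡m⊖n m n ⟩
  m ⊖ n          ≤⟨ ℤₚ.⊖-monoˡ-≤ n m≤1+n ⟩
  suc n ⊖ n      ≡⟨ ℤₚ.⊖-≥ (n≤1+n n) ⟩
  + (suc n ∸ n)  ≡⟨ cong +_ (m+n∸n≡m 1 n) ⟩
  + 1            ∎
  where open ℤₚ.≤-Reasoning

InAlph⇒InS : (n : ℕ) → n ≥ 3 → (G : Graph n) → (a : Letter) → InAlph G a → InS a
InAlph⇒InS _ _ G _ (_ , _ , _ , -∞    , _     , _  , _  , refl) = tt
InAlph⇒InS _ _ G _ (_ , _ , _ , fin _ , -∞    , _  , _  , refl) = tt
InAlph⇒InS _ _ G _ (i , _ , _ , fin x , fin y , Lx , Ly , refl) =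
  m≤1+n⇒m-n≤1 (L-step≤1 G (m≤n+m 2 i) Lx (subst (λ k → IsL G k (fin y)) (+-suc i 2) Ly))

-- Graphs realising the letters

edgeless : ∀ n → Graph n
edgeless n = record { E = λ _ _ → false ; E-sym = λ _ _ → refl ; E-irr = λ _ → refl }

edgeless-noInducedTree : ∀ {n i} → 2 ≤ i → IsL (edgeless n) i -∞
edgeless-noInducedTree {n} 2≤i (S , (connected , _) , ∣S∣≡i)
  with 0<∣p∣⇒Nonempty S (subst (0 <_) (sym ∣S∣≡i) (≤-trans (s≤s z≤n) 2≤i))
... | u , u∈ = <⇒≱ (subst (1 <_) (sym ∣S∣≡i) 2≤i) (p⊆⁅x⁆⇒∣p∣≤1 S⊆⁅u⁆)
  where
  open GraphProperties (edgeless n)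
  S⊆⁅u⁆ : S ⊆ ⁅ u ⁆
  S⊆⁅u⁆ {w} w∈ =
    from x∈⁅y⁆⇔x≡y (sym (walk-preserves {Q = u ≡_} (λ _ ()) (connected u w u∈ w∈) refl))

module RelationGraph {R : ℕ → ℕ → Set} (R? : ∀ a b → Dec (R a b)) (R-irrefl : ∀ {a} → ¬ R a a)
                     (n : ℕ) where

  Adjacent : ℕ → ℕ → Set
  Adjacent a b = R a b ⊎ R b a

  adjacent? : ∀ a b → Dec (Adjacent a b)
  adjacent? a b = R? a b ⊎-dec R? b a

  graph : Graph n
  graph = record
    { E     = λ u v → does (adjacent? (toℕ u) (toℕ v))
    ; E-sym = λ u v → ∨-comm (does (R? (toℕ u) (toℕ v))) (does (R? (toℕ v) (toℕ u)))
    ; E-irr = λ v → cong₂ _∨_ (dec-false (R? _ _) R-irrefl) (dec-false (R? _ _) R-irrefl)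
    }

  adjacent⇒E : ∀ {u v} → Adjacent (toℕ u) (toℕ v) → E graph u v ≡ true
  adjacent⇒E = dec-true (adjacent? _ _)

  E⇒adjacent : ∀ {u v} → E graph u v ≡ true → Adjacent (toℕ u) (toℕ v)
  E⇒adjacent {u} {v} e = invert (subst (Reflects _) e (proof (adjacent? (toℕ u) (toℕ v))))

-- Vertices 0, …, m form the star K(1,m) with centre 0; vertices m + 1, …, 2m + 2 form a path.
module StarAndPath (m : ℕ) where

  data Arc : ℕ → ℕ → Set where
    spoke : ∀ {b} → 1 ≤ b → b ≤ m → Arc 0 b
    link  : ∀ {a} → m < a → Arc a (suc a)

  arc? : ∀ a b → Dec (Arc a b)
  arc? zero b with 1 ≤? b | b ≤? m
  ... | yes 1≤b | yes b≤m = yes (spoke 1≤b b≤m)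
  ... | no  1≰b | _       = no λ { (spoke 1≤b _) → 1≰b 1≤b ; (link ()) }
  ... | yes _   | no  b≰m = no λ { (spoke _ b≤m) → b≰m b≤m ; (link ()) }
  arc? (suc a) b with m <? suc a | b ≟ suc (suc a)
  ... | yes m<a | yes refl = yes (link m<a)
  ... | no  m≮a | _        = no λ { (link m<a) → m≮a m<a }
  ... | yes _   | no  b≢   = no λ { (link _) → b≢ refl }

  arc-irrefl : ∀ {a} → ¬ Arc a a
  arc-irrefl (spoke () _)

  top : ℕ
  top = 2 + (m + m)

  N : ℕ
  N = suc top

  open RelationGraph arc? arc-irrefl N

  G : Graph N
  G = graph

  open GraphProperties G

  private variable
    a b c : ℕ
    t : ℕ
    u w : Fin N

  adjacent-lower : Adjacent a b → b < a → Arc b a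
  adjacent-lower (inj₁ (link _)) b<a = ⊥-elim (<⇒≱ b<a (n≤1+n _))
  adjacent-lower (inj₂ arc)      _   = arc

  arc-source-unique : Arc b a → Arc c a → b ≡ c
  arc-source-unique (spoke _ _)   (spoke _ _) = refl
  arc-source-unique (spoke _ a≤m) (link m<c)  = ⊥-elim (<⇒≱ m<c (≤-trans (n≤1+n _) a≤m))
  arc-source-unique (link m<b)    (spoke _ a≤m) = ⊥-elim (<⇒≱ m<b (≤-trans (n≤1+n _) a≤m))
  arc-source-unique (link _)      (link _)    = refl

  star-closed : a ≤ m → Adjacent a b → b ≤ m
  star-closed _   (inj₁ (spoke _ b≤m)) = b≤m
  star-closed a≤m (inj₁ (link m<a))    = ⊥-elim (<⇒≱ m<a a≤m)
  star-closed _   (inj₂ (spoke _ _))   = z≤n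
  star-closed a≤m (inj₂ (link _))      = ≤-trans (n≤1+n _) a≤m

  star-neighbour : b ≤ m → Adjacent (suc a) b → b ≡ 0
  star-neighbour b≤m (inj₁ (link m<a)) = ⊥-elim (<⇒≱ m<a (≤-trans (n≤1+n _) b≤m))
  star-neighbour _   (inj₂ (spoke _ _)) = refl
  star-neighbour b≤m (inj₂ (link m<b)) = ⊥-elim (<⇒≱ m<b b≤m)

  first-neighbour : m < b → Adjacent (suc m) b → b ≡ suc (suc m)
  first-neighbour _   (inj₁ (link _))   = refl
  first-neighbour ()  (inj₂ (spoke _ _))
  first-neighbour m<m (inj₂ (link _))   = ⊥-elim (<-irrefl refl m<m)

  last-neighbour : m < b → b ≤ top → Adjacent top b → b ≡ suc (m + m)
  last-neighbour _ b≤top (inj₁ (link _))   = ⊥-elim (<-irrefl refl b≤top)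
  last-neighbour () _    (inj₂ (spoke _ _))
  last-neighbour _ _     (inj₂ (link _))   = refl

  acyclic : ∀ S → ¬ Cycle G S
  acyclic S = lower-neighbour-unique⇒acyclic λ ea eb a<v b<v → Finₚ.toℕ-injective
    (arc-source-unique (adjacent-lower (E⇒adjacent ea) a<v) (adjacent-lower (E⇒adjacent eb) b<v))

  m<top : m < top
  m<top = s≤s (≤-trans (m≤m+n m m) (n≤1+n _))

  star : ℕ → Subset N
  star t = below (suc t)

  ∣star∣ : t ≤ m → ∣ star t ∣ ≡ suc t
  ∣star∣ {t} t≤m = ∣below∣ (suc t) (s≤s (≤-trans t≤m (<⇒≤ m<top)))

  0∈star : ∀ t → zero ∈ star t
  0∈star t = ∈-below⁺ {k = suc t} z<s

  star-isInducedTree : t ≤ m → IsInducedTree G (star t)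
  star-isInducedTree {t} t≤m = descending⇒connected (0∈star t) descend , acyclic (star t)
    where
    descend : u ∈ star t → u ≢ zero → ∃ λ w → w ∈ star t × E G u w ≡ true × toℕ w < toℕ u
    descend {zero}  _  0≢0 = ⊥-elim (0≢0 refl)
    descend {suc u} u∈ _   = zero , 0∈star t , adjacent⇒E (inj₂ (spoke (s≤s z≤n) u≤m)) , z<s
      where u≤m = ≤-trans (s≤s⁻¹ (∈-below⁻ u∈)) t≤m

  star-leaf : t ≤ m → u ∈ star t → u ≢ zero → u ∈ leafSet (star t)
  star-leaf {u = zero}        _   _  0≢0 = ⊥-elim (0≢0 refl)
  star-leaf {t} {suc u} t≤m u∈ _   = ∈-leafSet⁺ u∈ (neighbour-index-unique⇒deg≡1
    (λ w∈ e → star-neighbour (star-bound w∈) (E⇒adjacent e)) (0∈star t)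
    (adjacent⇒E (inj₂ (spoke (s≤s z≤n) (star-bound u∈)))))
    where
    star-bound : w ∈ star t → toℕ w ≤ m
    star-bound w∈ = ≤-trans (s≤s⁻¹ (∈-below⁻ w∈)) t≤m

  leaves-star : 2 ≤ t → t ≤ m → leaves G (star t) ≡ t
  leaves-star {t} 2≤t t≤m = ≤-antisym
    (∣S∣≡1+k⇒leaves≤k (proj₁ (star-isInducedTree t≤m)) 2≤t (∣star∣ t≤m))
    (≤-trans (≤-reflexive (sym ∣star-0∣)) (p⊆q⇒∣p∣≤∣q∣ λ u∈ →
      let (u∈S , u≢0) = x∈p-y⁻ u∈ in star-leaf t≤m u∈S u≢0))
    where
    ∣star-0∣ : ∣ star t - zero ∣ ≡ t
    ∣star-0∣ = suc-injective (trans (sym (x∈p⇒∣p∣≡1+∣p-x∣ (0∈star t))) (∣star∣ t≤m))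

  L-star : 2 ≤ t → t ≤ m → IsL G (suc t) (fin t)
  L-star {t} 2≤t t≤m = (star t , star-isInducedTree t≤m , ∣star∣ t≤m , leaves-star 2≤t t≤m) ,
                   λ S S-tree ∣S∣≡1+t → ∣S∣≡1+k⇒leaves≤k (proj₁ S-tree) 2≤t ∣S∣≡1+t

  path : Subset N
  path = ∁ (below (suc m))

  ∈-path⁺ : m < toℕ u → u ∈ path
  ∈-path⁺ m<u = x∉p⇒x∈∁p λ u∈ → <⇒≱ m<u (s≤s⁻¹ (∈-below⁻ u∈))

  ∈-path⁻ : u ∈ path → m < toℕ u
  ∈-path⁻ u∈ = ≰⇒> λ u≤m → x∈∁p⇒x∉p u∈ (∈-below⁺ (s≤s u≤m))

  ∣path∣ : ∣ path ∣ ≡ 2 + m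
  ∣path∣ = begin
    ∣ path ∣                     ≡⟨ ∣∁p∣≡n∸∣p∣ (below (suc m)) ⟩
    N ∸ ∣ below {N} (suc m) ∣  ≡⟨ cong (N ∸_) (∣below∣ (suc m) (s≤s (<⇒≤ m<top))) ⟩
    (2 + m) + m ∸ m            ≡⟨ m+n∸n≡m (2 + m) m ⟩
    2 + m                      ∎
    where open ≡-Reasoning

  first last : Fin N
  first = fromℕ< (s≤s m<top)
  last  = fromℕ top

  toℕ-first : toℕ first ≡ suc m
  toℕ-first = Finₚ.toℕ-fromℕ< (s≤s m<top)

  first∈path : first ∈ path
  first∈path = ∈-path⁺ (≤-reflexive (sym toℕ-first))

  last∈path : last ∈ path
  last∈path = ∈-path⁺ (subst (m <_) (sym (Finₚ.toℕ-fromℕ top)) m<top)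

  link-edge : m < toℕ w → toℕ u ≡ suc (toℕ w) → E G u w ≡ true
  link-edge {w} m<w u≡1+w = adjacent⇒E (inj₂ (subst (Arc (toℕ w)) (sym u≡1+w) (link m<w)))

  lower-neighbour : u ∈ path → u ≢ first → ∃ λ w → w ∈ path × E G u w ≡ true × toℕ w < toℕ u
  lower-neighbour {zero}  u∈ _      = ⊥-elim (<⇒≱ (∈-path⁻ u∈) z≤n)
  lower-neighbour {suc u} u∈ u≢first =
    inject₁ u , ∈-path⁺ m<w , link-edge m<w (cong suc (sym (Finₚ.toℕ-inject₁ u))) ,
    s≤s (≤-reflexive (Finₚ.toℕ-inject₁ u))
    where
    m<u : m < toℕ u
    m<u = ≤∧≢⇒< (s≤s⁻¹ (∈-path⁻ u∈))
      λ m≡u → u≢first (Finₚ.toℕ-injective (trans (cong suc (sym m≡u)) (sym toℕ-first)))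
    m<w : m < toℕ (inject₁ u)
    m<w = subst (m <_) (sym (Finₚ.toℕ-inject₁ u)) m<u

  upper-neighbour : u ∈ path → u ≢ last → ∃ λ w → w ∈ path × E G u w ≡ true × toℕ u < toℕ w
  upper-neighbour {u} u∈ u≢last with view u
  ... | ‵fromℕ = ⊥-elim (u≢last refl)
  ... | ‵inject₁ v = suc v , ∈-path⁺ {u = suc v} (s≤s (<⇒≤ m<v)) ,
    trans (E-sym G (inject₁ v) (suc v))
      (link-edge {u = suc v} (∈-path⁻ u∈) (cong suc (sym (Finₚ.toℕ-inject₁ v)))) ,
    s≤s (≤-reflexive (Finₚ.toℕ-inject₁ v))
    where
    m<v : m < toℕ v
    m<v = subst (m <_) (Finₚ.toℕ-inject₁ v) (∈-path⁻ u∈)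

  path-isInducedTree : IsInducedTree G path
  path-isInducedTree = descending⇒connected first∈path lower-neighbour , acyclic path

  first≢last : first ≢ last
  first≢last eq = <⇒≢ (s≤s (s≤s (m≤m+n m m)))
    (trans (sym toℕ-first) (trans (cong toℕ eq) (Finₚ.toℕ-fromℕ top)))

  first-leaf : first ∈ leafSet path
  first-leaf = let (w , w∈ , first~w , _) = upper-neighbour first∈path first≢last in
    ∈-leafSet⁺ first∈path (neighbour-index-unique⇒deg≡1 index w∈ first~w)
    where
    index : w ∈ path → E G first w ≡ true → toℕ w ≡ suc (suc m)
    index {w} w∈ e =
      first-neighbour (∈-path⁻ w∈) (subst (λ a → Adjacent a (toℕ w)) toℕ-first (E⇒adjacent e))

  last-leaf : last ∈ leafSet path
  last-leaf = let (w , w∈ , last~w , _) = lower-neighbour last∈path (first≢last ∘ sym) in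
    ∈-leafSet⁺ last∈path (neighbour-index-unique⇒deg≡1 index w∈ last~w)
    where
    index : w ∈ path → E G last w ≡ true → toℕ w ≡ suc (m + m)
    index {w} w∈ e = last-neighbour (∈-path⁻ w∈) (s≤s⁻¹ (Finₚ.toℕ<n w))
      (subst (λ a → Adjacent a (toℕ w)) (Finₚ.toℕ-fromℕ top) (E⇒adjacent e))

  path-leaf⇒end : w ∈ leafSet path → w ≡ first ⊎ w ≡ last
  path-leaf⇒end {w} w-leaf with w Fin.≟ first | w Fin.≟ last
  ... | yes w≡first | _           = inj₁ w≡first
  ... | no  _       | yes w≡last  = inj₂ w≡last
  ... | no  w≢first | no  w≢last  = ⊥-elim (<⇒≱ 2≤deg (≤-reflexive dw))
    where
    w∈ : w ∈ path
    w∈ = proj₁ (∈-leafSet⁻ {S = path} w-leaf)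
    dw : deg G path w ≡ 1
    dw = proj₂ (∈-leafSet⁻ {S = path} w-leaf)
    2≤deg : 2 ≤ deg G path w
    2≤deg with lower-neighbour w∈ w≢first | upper-neighbour w∈ w≢last
    ... | l , l∈ , w~l , l<w | r , r∈ , w~r , w<r =
      x≢y⇒2≤∣p∣ (∈-nbhd⁺ l∈ w~l) (∈-nbhd⁺ r∈ w~r) λ { refl → <-asym l<w w<r }

  leaves-path : leaves G path ≡ 2
  leaves-path = ≤-antisym (p⊆⁅x,y⁆⇒∣p∣≤2 path-leaf⇒end) (x≢y⇒2≤∣p∣ first-leaf last-leaf first≢last)

  -- An induced tree meeting the star stays inside it, and the star is too small.
  large-tree≡path : ∀ {S} → IsInducedTree G S → ∣ S ∣ ≡ 2 + m → S ≡ path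
  large-tree≡path {S} (connected , _) ∣S∣≡2+m =
    p⊆q∧∣q∣≤∣p∣⇒p≡q S⊆path (≤-reflexive (trans ∣path∣ (sym ∣S∣≡2+m)))
    where
    S⊆path : S ⊆ path
    S⊆path {w} w∈ with m <? toℕ w
    ... | yes m<w = ∈-path⁺ m<w
    ... | no  m≮w = ⊥-elim (<⇒≱ (≤-reflexive (sym ∣S∣≡2+m))
                              (≤-trans (p⊆q⇒∣p∣≤∣q∣ S⊆star) (≤-reflexive (∣star∣ ≤-refl))))
      where
      S⊆star : S ⊆ star m
      S⊆star {x} x∈ = ∈-below⁺ (s≤s (walk-preserves {Q = λ y → toℕ y ≤ m}
        (λ _ e y≤m → star-closed y≤m (E⇒adjacent e)) (connected w x w∈ x∈) (≮⇒≥ m≮w)))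

  L-path : IsL G (2 + m) (fin 2)
  L-path = (path , path-isInducedTree , ∣path∣ , leaves-path) ,
           λ S S-tree ∣S∣≡2+m →
             ≤-reflexive (trans (cong (leaves G) (large-tree≡path S-tree ∣S∣≡2+m)) leaves-path)

InS⇒InAlph : (a : Letter) → InS a → Σ ℕ λ n → n ≥ 3 × Σ (Graph n) λ G → InAlph G a
InS⇒InAlph ω _ = 4 , s≤s (s≤s (s≤s z≤n)) , edgeless 4 , 1 , ≤-refl , ≤-refl , -∞ , -∞ ,
  edgeless-noInducedTree (s≤s (s≤s z≤n)) , edgeless-noInducedTree (s≤s (s≤s z≤n)) , refl
InS⇒InAlph (num (+ 0)) _ = N , m≤m+n 3 _ , G , 1 , s≤s z≤n , s≤s z≤n , fin 2 , fin 2 ,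
  L-star ≤-refl ≤-refl , L-path , refl
  where open StarAndPath 2
InS⇒InAlph (num (+ 1)) _ = N , m≤m+n 3 _ , G , 1 , s≤s z≤n , s≤s z≤n , fin 2 , fin 3 ,
  L-star ≤-refl (n≤1+n 2) , L-star (n≤1+n 2) ≤-refl , refl
  where open StarAndPath 3
InS⇒InAlph (num (+ suc (suc _))) (ℤ.+≤+ (s≤s ()))
InS⇒InAlph (num -[1+ q ]) _ =
  N , m≤m+n 3 _ , G , 2 + q , s≤s z≤n , ≤-trans (n≤1+n _) (m≤m+n (3 + q) _) , fin (3 + q) , fin 2 ,
  subst (λ k → IsL G k (fin (3 + q))) (cong (λ k → 2 + k) (+-comm 2 q))
        (L-star (s≤s (s≤s z≤n)) ≤-refl) ,
  subst (λ k → IsL G k (fin 2)) (cong (λ k → 2 + k) (+-comm 3 q)) L-path , refl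
  where open StarAndPath (3 + q)

lemma1 : ((n : ℕ) → n ≥ 3 → (G : Graph n) → (a : Letter) → InAlph G a → InS a)
       × ((a : Letter) → InS a → Σ ℕ λ n → n ≥ 3 × Σ (Graph n) λ G → InAlph G a)
lemma1 = InAlph⇒InS , InS⇒InAlph
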